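{- Let $\mathscr{L}$ be a set and let $W:\mathcal{P}(\mathscr{L})\to\mathcal{P}(\mathscr{L})$ be a $q$-consequence operator that is not reflexive (i.e. there is $\Gamma\subseteq\mathscr{L}$ with $\Gamma\not\subseteq W(\Gamma)$). Then the logical structure $(\mathscr{L},W)$ is inferentially $3$-valued.
   Context: A logical structure is a pair $(\mathscr{L},W)$ with $\mathscr{L}$ a set and $W:\mathcal{P}(\mathscr{L})\to\mathcal{P}(\mathscr{L})$. $W$ is a $q$-consequence operator if (i) $\Gamma\subseteq\Sigma$ implies $W(\Gamma)\subseteq W(\Sigma)$ (monotonicity) and (ii) $W(W(\Gamma)\cup\Gamma)=W(\Gamma)$ for all $\Gamma\subseteq\mathscr{L}$ (quasi-closure). A semantics for $\mathscr{L}$ is a tuple $\mathfrak{S}=(\mathbf{M},\{\models_i\}_{i\in I},S,\mathcal{P}(\mathscr{L}))$ where $\mathbf{M}$ is a set, $I\neq\emptyset$, each $\models_i\subseteq\mathbf{M}\times\mathcal{P}(\mathscr{L})$, and $\emptyset\subsetneq S\subseteq\{(\models_i,\models_j):(i,j)\in I\times I\}$. It induces $W_{\mathfrak{S}}$ by: $\alpha\in W_{\mathfrak{S}}(\Gamma)$ iff for all $(\models_i,\models_j)\in S$ and all $m\in\mathbf{M}$, $m\models_i\Gamma$ implies $m\models_j\{\alpha\}$. For a cardinal $\kappa$, $\mathfrak{S}$ is functionally $\kappa$-valued if $\emptyset\subsetneq\mathbf{M}\subseteq A^{\mathscr{L}}$ for some set $A$ with $|A|=\kappa$, and there are sets $\emptyset\subsetneq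 D_i$ ($i\in I$) with $\bigcup_{i\in I}D_i\subsetneq A$ such that for all $m\in\mathbf{M}$, $i\in I$, $\Gamma\subseteq\mathscr{L}$: $m\models_i\Gamma$ iff $m(\Gamma)\subseteq D_i$. A logical structure $(\mathscr{L},W)$ is inferentially $\kappa$-valued if $\kappa>1$, $W=W_{\mathfrak{S}}$ for some functionally $\kappa$-valued semantics $\mathfrak{S}$ for $\mathscr{L}$, and $W\neq W_{\mathfrak{T}}$ for every functionally $\mu$-valued semantics $\mathfrak{T}$ for $\mathscr{L}$ with $\mu<\kappa$. -}

module Defs where

open import Level using (0ℓ)
open import Data.Nat using (ℕ; _<_)
open import Data.Fin using (Fin)
open import Data.Product using (Σ; ∃; ∃-syntax; _×_; _,_)
open import Relation.Unary using (Pred; _⊆_)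
open import Relation.Nullary using (¬_)
open import Relation.Binary.PropositionalEquality using (_≡_)
open import Function.Bundles using (_↔_; _⇔_)
open import Function.Definitions using (Injective)

𝒫 : Set → Set₁
𝒫 X = Pred X 0ℓ

⟦_⟧ : {𝓛 : Set} → 𝓛 → 𝒫 𝓛
⟦ α ⟧ = λ β → β ≡ α

_∪_ : {𝓛 : Set} → 𝒫 𝓛 → 𝒫 𝓛 → 𝒫 𝓛
(Γ ∪ Σ') = λ α → Data.Sum._⊎_ (Γ α) (Σ' α)
  where import Data.Sum

IsQConsequence : {𝓛 : Set} → (𝒫 𝓛 → 𝒫 𝓛) → Set₁
IsQConsequence {𝓛} W =
  ((Γ Σ' : 𝒫 𝓛) → Γ ⊆ Σ' → W Γ ⊆ W Σ')
  × ((Γ : 𝒫 𝓛) → (W (W Γ ∪ Γ) ⊆ W Γ) × (W Γ ⊆ W (W Γ ∪ Γ)))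

IsReflexive : {𝓛 : Set} → (𝒫 𝓛 → 𝒫 𝓛) → Set₁
IsReflexive {𝓛} W = (Γ : 𝒫 𝓛) → Γ ⊆ W Γ

-- A semantics (M, {⊨_i}_{i∈I}, S, P(𝓛)) for 𝓛.
-- S ⊆ {(⊨_i, ⊨_j)} is given by a set of index pairs (i , j).
record Semantics (𝓛 : Set) : Set₁ where
  field
    M    : Set
    I    : Set
    I-ne : I
    sat  : I → M → 𝒫 𝓛 → Set
    S    : I → I → Set
    S-ne : ∃[ i ] ∃[ j ] S i j

W[_] : {𝓛 : Set} → Semantics 𝓛 → 𝒫 𝓛 → 𝒫 𝓛
W[ 𝔖 ] Γ α = ∀ i j → S i j → ∀ m → sat i m Γ → sat j m ⟦ α ⟧
  where open Semantics 𝔖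

-- functionally κ-valued semantics (κ a finite cardinal, |A| = κ via A ↔ Fin κ).
-- M ⊆ A^𝓛 is expressed by an injection ev : M → (𝓛 → A).
IsFunctionallyValued : {𝓛 : Set} → ℕ → Semantics 𝓛 → Set₁
IsFunctionallyValued {𝓛} κ 𝔖 =
  Σ Set λ A → (A ↔ Fin κ) ×
  Σ (M → (𝓛 → A)) λ ev → Injective _≡_ _≡_ ev × M ×
  Σ (I → Pred A 0ℓ) λ D →
    ((i : I) → ∃ λ a → D i a)
    × (∃ λ a → (i : I) → ¬ D i a)
    × ((m : M) (i : I) (Γ : 𝒫 𝓛) → sat i m Γ ⇔ (∀ α → Γ α → D i (ev m α)))
  where open Semantics 𝔖

_≐_ : {𝓛 : Set} → (𝒫 𝓛 → 𝒫 𝓛) → (𝒫 𝓛 → 𝒫 𝓛) → Set₁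
_≐_ {𝓛} W V = (Γ : 𝒫 𝓛) → (W Γ ⊆ V Γ) × (V Γ ⊆ W Γ)

IsInferentiallyValued : {𝓛 : Set} → ℕ → (𝒫 𝓛 → 𝒫 𝓛) → Set₁
IsInferentiallyValued {𝓛} κ W =
  (1 < κ)
  × (Σ (Semantics 𝓛) λ 𝔖 → IsFunctionallyValued κ 𝔖 × (W ≐ W[ 𝔖 ]))
  × ((μ : ℕ) → μ < κ → (𝔗 : Semantics 𝓛) → IsFunctionallyValued μ 𝔗 → ¬ (W ≐ W[ 𝔗 ]))

{-# OPTIONS --safe #-}
-- Upper bound: Malinowski's three values rejected, neither, accepted, a premise being
-- designated when not rejected and a conclusion when accepted.  The models are the
-- valuations accepting W Δ, where Δ is their non-rejected part.  By monotonicity a model not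
-- rejecting Γ accepts W Γ; conversely the valuation accepting W Γ, putting the rest of Γ at
-- neither and rejecting everything else is a model by quasi-closure, and it accepts nothing
-- outside W Γ.
-- Lower bound: with at most two values, one of them outside every designated set, each
-- (nonempty) designated set consists of the other value alone, so all of them coincide and
-- the induced operator is reflexive.
module Submission where

open import Defs
open import Level using (0ℓ)
open import Axiom.ExcludedMiddle using (ExcludedMiddle)
open import Data.Bool.Properties using (T-irrelevant)
open import Data.Empty using (⊥)
open import Data.Fin using (Fin; zero; suc)
open import Data.Nat as ℕ using (_<_; z≤n; s≤s)
open import Data.Product using (Σ; _,_; proj₁; proj₂)
open import Data.Sum using (inj₁; inj₂)
open import Data.Unit using (⊤; tt)
open import Function.Bundles using (_↔_; Injection; Equivalence)
open import Function.Construct.Identity using (↔-id; ⇔-id)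
open import Function.Properties.Inverse using (↔⇒↣)
open import Relation.Binary.PropositionalEquality using (_≡_; _≢_; refl; cong; subst)
open import Relation.Nullary using (¬_; contradiction)
open import Relation.Nullary.Decidable using (yes; no; True; toWitness; fromWitness)
open import Relation.Unary using (_⊆_)

≐-reflexive : {𝓛 : Set} {W V : 𝒫 𝓛 → 𝒫 𝓛} → W ≐ V → IsReflexive V → IsReflexive W
≐-reflexive W≐V reflexive Γ Γα = proj₂ (W≐V Γ) (reflexive Γ Γα)

≢-unique : ∀ {n} → n < 3 → {x y z : Fin n} → x ≢ z → y ≢ z → x ≡ y
≢-unique _ {zero}     {zero}                _   _   = refl
≢-unique _ {suc zero} {suc zero}            _   _   = refl
≢-unique _ {zero}     {suc zero} {zero}     x≢z _   = contradiction refl x≢z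
≢-unique _ {zero}     {suc zero} {suc zero} _   y≢z = contradiction refl y≢z
≢-unique _ {suc zero} {zero}     {zero}     _   y≢z = contradiction refl y≢z
≢-unique _ {suc zero} {zero}     {suc zero} x≢z _   = contradiction refl x≢z
≢-unique {ℕ.suc (ℕ.suc (ℕ.suc _))} (s≤s (s≤s (s≤s ())))

↔-≢-unique : ∀ {A : Set} {n} → n < 3 → A ↔ Fin n → {x y z : A} → x ≢ z → y ≢ z → x ≡ y
↔-≢-unique n<3 A↔Fin x≢z y≢z =
  injective (≢-unique n<3 (λ e → x≢z (injective e)) (λ e → y≢z (injective e)))
  where open Injection (↔⇒↣ A↔Fin)

functionallyValued<3⇒reflexive : ∀ {𝓛 : Set} {μ} (𝔗 : Semantics 𝓛) →
  μ < 3 → IsFunctionallyValued μ 𝔗 → IsReflexive W[ 𝔗 ]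
functionallyValued<3⇒reflexive 𝔗 μ<3
  (A , A↔Fin , ev , _ , _ , D , D-nonempty , (a , a∉D) , sat⇔) Γ {α} Γα i j _ m m⊨Γ =
  Equivalence.from (sat⇔ m j ⟦ α ⟧) λ { _ refl → D-shared (Equivalence.to (sat⇔ m i Γ) m⊨Γ α Γα) }
  where
  open Semantics 𝔗
  D-shared : ∀ {x} → D i x → D j x
  D-shared Dix with D-nonempty j
  ... | b , Djb =
    subst (D j) (↔-≢-unique μ<3 A↔Fin {z = a} (λ { refl → a∉D j Djb }) (λ { refl → a∉D i Dix })) Djb

data Role : Set where
  premise conclusion : Role

module QSemantics (em : ExcludedMiddle 0ℓ) {𝓛 : Set} (W : 𝒫 𝓛 → 𝒫 𝓛) where

  rejected neither accepted : Fin 3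
  rejected = zero
  neither  = suc zero
  accepted = suc (suc zero)

  Designated : Role → Fin 3 → Set
  Designated premise    v = v ≢ rejected
  Designated conclusion v = v ≡ accepted

  Admissible : Role → Role → Set
  Admissible premise conclusion = ⊤
  Admissible _       _          = ⊥

  nonRejected : (𝓛 → Fin 3) → 𝒫 𝓛
  nonRejected v β = v β ≢ rejected

  IsModel : (𝓛 → Fin 3) → Set
  IsModel v = W (nonRejected v) ⊆ λ β → v β ≡ accepted

  -- A decision rather than a proof of IsModel v: T-irrelevant then makes valuation
  -- injective without function extensionality.
  Model : Set
  Model = Σ (𝓛 → Fin 3) λ v → True (em {IsModel v})

  valuation : Model → 𝓛 → Fin 3
  valuation = proj₁

  valuation-injective : ∀ {m n} → valuation m ≡ valuation n → m ≡ n
  valuation-injective {v , p} {.v , q} refl = cong (v ,_) (T-irrelevant p q)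

  _⊨[_]_ : Model → Role → 𝒫 𝓛 → Set
  m ⊨[ i ] Γ = ∀ α → Γ α → Designated i (valuation m α)

  semantics : Semantics 𝓛
  semantics = record
    { M = Model ; I = Role ; I-ne = premise ; sat = λ i m Γ → m ⊨[ i ] Γ
    ; S = Admissible ; S-ne = premise , conclusion , tt }

  semantics-3-valued : IsFunctionallyValued 3 semantics
  semantics-3-valued =
    Fin 3 , ↔-id (Fin 3) , valuation , valuation-injective
    , ((λ _ → accepted) , fromWitness (λ {_} _ → refl)) , Designated
    , (λ { premise → accepted , (λ ()) ; conclusion → accepted , refl })
    , (rejected , λ { premise r≢r → r≢r refl ; conclusion () })
    , (λ _ _ _ → ⇔-id _)

  canonical : 𝒫 𝓛 → 𝓛 → Fin 3
  canonical Γ β with em {W Γ β} | em {Γ β}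
  ... | yes _ | _     = accepted
  ... | no _  | yes _ = neither
  ... | no _  | no _  = rejected

  canonical-accepted : ∀ Γ → W Γ ⊆ λ β → canonical Γ β ≡ accepted
  canonical-accepted Γ {β} WΓβ with em {W Γ β} | em {Γ β}
  ... | yes _   | _ = refl
  ... | no ¬WΓβ | _ = contradiction WΓβ ¬WΓβ

  accepted-canonical : ∀ Γ {β} → canonical Γ β ≡ accepted → W Γ β
  accepted-canonical Γ {β} eq with em {W Γ β} | em {Γ β}
  accepted-canonical Γ _  | yes WΓβ | _     = WΓβ
  accepted-canonical Γ () | no _    | yes _
  accepted-canonical Γ () | no _    | no _

  canonical-nonRejected : ∀ Γ → Γ ⊆ nonRejected (canonical Γ)
  canonical-nonRejected Γ {β} Γβ with em {W Γ β} | em {Γ β}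
  ... | yes _ | _      = λ ()
  ... | no _  | yes _  = λ ()
  ... | no _  | no ¬Γβ = contradiction Γβ ¬Γβ

  nonRejected-canonical : ∀ Γ → nonRejected (canonical Γ) ⊆ W Γ ∪ Γ
  nonRejected-canonical Γ {β} ≢rejected with em {W Γ β} | em {Γ β}
  ... | yes WΓβ | _      = inj₁ WΓβ
  ... | no _    | yes Γβ = inj₂ Γβ
  ... | no _    | no _   = contradiction refl ≢rejected

  canonical-isModel : IsQConsequence W → ∀ Γ → IsModel (canonical Γ)
  canonical-isModel (monotone , quasiClosed) Γ WΔβ =
    canonical-accepted Γ (proj₁ (quasiClosed Γ) (monotone _ _ (nonRejected-canonical Γ) WΔβ))

  W[semantics]⊆W : IsQConsequence W → ∀ Γ → W[ semantics ] Γ ⊆ W Γ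
  W[semantics]⊆W isQ Γ {α} ⊨α = accepted-canonical Γ
    (⊨α premise conclusion tt canonicalModel (λ _ → canonical-nonRejected Γ) α refl)
    where
    canonicalModel : Model
    canonicalModel = canonical Γ , fromWitness (λ {β} → canonical-isModel isQ Γ {β})

  W⊆W[semantics] : (∀ Γ Δ → Γ ⊆ Δ → W Γ ⊆ W Δ) → ∀ Γ → W Γ ⊆ W[ semantics ] Γ
  W⊆W[semantics] monotone Γ WΓα premise conclusion _ (v , isModel) v⊨Γ _ refl =
    toWitness isModel (monotone _ _ (λ {β} → v⊨Γ β) WΓα)

  W≐W[semantics] : IsQConsequence W → W ≐ W[ semantics ]
  W≐W[semantics] isQ Γ = W⊆W[semantics] (proj₁ isQ) Γ , W[semantics]⊆W isQ Γ

mainTheorem1 : ExcludedMiddle 0ℓ → (𝓛 : Set) (W : 𝒫 𝓛 → 𝒫 𝓛) → IsQConsequence W → ¬ IsReflexive W → IsInferentiallyValued 3 W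
mainTheorem1 em 𝓛 W isQ irreflexive =
    s≤s (s≤s z≤n)
  , (semantics , semantics-3-valued , W≐W[semantics] isQ)
  , λ _ μ<3 𝔗 valued W≐W[𝔗] →
      irreflexive (≐-reflexive W≐W[𝔗] (functionallyValued<3⇒reflexive 𝔗 μ<3 valued))
  where open QSemantics em W
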